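{- Let $k\ge1$, $n\ge1$, and let $P$ be a length-$n$ read-once branching program over alphabet $\{0,1\}^k$ that computes $\mathsf{ApproxCount}_{k\text{ -parallel}}[n,n/3]$, with potential $\Phi_n$ as defined in the context. Then $$\Phi_n\ \le\ (\lfloor n/10\rfloor+1)^k\cdot\frac{2kn}{3}.$$
   Context: A length-$n$ read-once branching program (ROBP) over alphabet $\Sigma$: layered multigraph with layers $V_0,\dots,V_n$, $V_0=\{v_{\mathrm{start}}\}$, each vertex of $V_i$ ($i<n$) having $|\Sigma|$ outgoing edges into $V_{i+1}$ labeled by distinct symbols, vertices of $V_n$ labeled with outputs, every vertex reachable by some input; an input follows from $v_{\mathrm{start}}$ the edges labeled $x_1,\dots,x_n$, the output is the label of the final vertex, and a prefix $(x_1,\dots,x_t)$ reaches the vertex of $V_t$ on the path. $\mathsf{ApproxCount}_{k\text{ -parallel}}[n,\Delta]$: on input $x\in(\{0,1\}^k)^n$ output reals $(\hat S_1,\dots,\hat S_k)$ with $|\hat S_j-\#\{i:(x_i)_j=1\}|\le\Delta$ for all $j\in[k]$; $P$ computes it if the output is valid on every input. For $v\in V_t$, $R(v)=[a_1,b_1]\times\cdots\times[a_k,b_k]$ where $a_j,b_j$ are the minimum and maximum of $\#\{i\in[t]:(x_i)_j=1\}$ over prefixes reaching $v$; $\mathcal R_t=\{R(v):v\in V_t\}$. For $x\in\{0,\dots,\lfloor n/10\rfloor\}^k$, $\phi_n(x)=\max\{b_1+\cdots+b_k-x_1-\cdots-x_k\}$ over $R=\prod_j[a_j,b_j]\in\mathcal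 R_n$ with $x\in R$, and $\Phi_n=\sum_{x\in\{0,\dots,\lfloor n/10\rfloor\}^k}\phi_n(x)$.
   Formalization: The output labels of the vertices of $V_n$ are k-tuples of rationals rather than of reals. -}

module Defs where

open import Data.Nat using (ℕ; zero; suc; _+_; _*_; _∸_; _≤_; _<_; _⊓_; _⊔_; _/_; _≤?_)
open import Data.Nat.Properties using (<⇒≤; ≤-refl)
open import Data.Bool using (Bool; true; false; if_then_else_)
open import Data.Fin using (Fin; fromℕ<; _≟_)
open import Data.Vec as Vec using (Vec; []; _∷_; lookup)
open import Data.List as List using (List; []; _∷_; concatMap; map; filter; upTo; allFin; foldr)
open import Data.Nat.ListAction using (sum)
open import Data.Product using (∃; _×_)
open import Relation.Binary.PropositionalEquality using (_≡_)
open import Relation.Nullary using (Dec; yes; no)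
open import Relation.Nullary.Decidable using (_×-dec_)
open import Data.Vec.Relation.Unary.All as VAll using (all?)
open import Data.Rational as ℚ using (ℚ)
open import Data.Integer using (+_)

-- The alphabet {0,1}^k : a letter is a k-bit vector (true = 1).
Letter : ℕ → Set
Letter k = Vec Bool k

Input : ℕ → ℕ → Set
Input n k = Vec (Letter k) n

-- Length-n ROBP over {0,1}^k with outputs in ℚ^k.
-- Layer V_t = Fin (width t) for t ≤ n; the |Σ| labelled out-edges of a vertex
-- of V_t (t < n) are given by the transition function  step t.
record ROBP (n k : ℕ) : Set where
  field
    width  : ℕ → ℕ
    width0 : width 0 ≡ 1
    start  : Fin (width 0)
    step   : (t : ℕ) → t < n → Fin (width t) → Letter k → Fin (width (suc t))
    out    : Fin (width n) → Vec ℚ k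

  state : Input n k → (t : ℕ) → t ≤ n → Fin (width t)
  state x zero    _ = start
  state x (suc t) p = step t p (state x t (<⇒≤ p)) (lookup x (fromℕ< p))

  final : Input n k → Fin (width n)
  final x = state x n ≤-refl

  -- every vertex is reached by some prefix (prefixes are exactly the
  -- length-t initial segments of full inputs)
  AllReachable : Set
  AllReachable = ∀ (t : ℕ) (p : t ≤ n) (v : Fin (width t)) → ∃ λ x → state x t p ≡ v

count : ∀ {n k} → Input n k → Fin k → ℕ
count x j = Vec.sum (Vec.map (λ a → if lookup a j then 1 else 0) x)

ComputesApproxCount : ∀ {n k} → ROBP n k → Set
ComputesApproxCount {n} {k} P =
  ∀ (x : Input n k) (j : Fin k) →
    ℚ.∣ lookup (ROBP.out P (ROBP.final P x)) j ℚ.- ((+ count x j) ℚ./ 1) ∣ ℚ.≤ ((+ n) ℚ./ 3)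

allVecs : ∀ {A : Set} (m : ℕ) → List A → List (Vec A m)
allVecs zero    xs = [] ∷ []
allVecs (suc m) xs = concatMap (λ a → map (a ∷_) (allVecs m xs)) xs

allInputs : (n k : ℕ) → List (Input n k)
allInputs n k = allVecs n (allVecs k (true ∷ false ∷ []))

module _ {n k : ℕ} (P : ROBP n k) where
  open ROBP P

  reaching : Fin (width n) → List (Input n k)
  reaching v = filter (λ x → final x ≟ v) (allInputs n k)

  -- R(v) = ∏_j [a_j(v), b_j(v)] : min / max of the j-th count over prefixes reaching v
  -- (the defaults n and 0 are neutral since counts lie in [0,n] and v is reachable)
  lo : Fin (width n) → Fin k → ℕ
  lo v j = foldr _⊓_ n (map (λ x → count x j) (reaching v))

  hi : Fin (width n) → Fin k → ℕ
  hi v j = foldr _⊔_ 0 (map (λ x → count x j) (reaching v))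

  InR : Vec ℕ k → Fin (width n) → Set
  InR y v = VAll.All (λ { (j , yj) → lo v j ≤ yj × yj ≤ hi v j }) (Vec.zip (Vec.allFin k) y)
    where open import Data.Product using (_,_)

  inR? : (y : Vec ℕ k) (v : Fin (width n)) → Dec (InR y v)
  inR? y v = all? (λ { (j , yj) → (lo v j ≤? yj) ×-dec (yj ≤? hi v j) }) (Vec.zip (Vec.allFin k) y)
    where open import Data.Product using (_,_)

  sumHi : Fin (width n) → ℕ
  sumHi v = Vec.sum (Vec.map (hi v) (Vec.allFin k))

  φ : Vec ℕ k → ℕ
  φ y = foldr _⊔_ 0 (map (λ v → sumHi v ∸ Vec.sum y) (filter (inR? y) (allFin (width n))))

  grid : List (Vec ℕ k)
  grid = allVecs k (upTo (suc (n / 10)))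

  Φ : ℕ
  Φ = sum (map φ grid)

{-# OPTIONS --safe #-}
module Submission where

-- Two inputs reaching the same final vertex get the same output, which is within n/3 of
-- both of their j-th counts; so these counts differ by at most 2n/3, i.e. b_j − a_j ≤ 2n/3
-- for every rectangle R(v).  For y ∈ R(v) this gives Σ_j b_j − Σ_j y_j ≤ Σ_j (b_j − a_j)
-- ≤ 2kn/3, so each of the (⌊n/10⌋+1)^k terms φ_n(y) of Φ_n is at most 2kn/3.
-- Everything is multiplied by 3 to stay in ℕ.

open import Defs
open import Data.Nat using (ℕ; zero; suc; _+_; _∸_; _*_; _^_; _≤_; _/_; z≤n; s≤s)

import Data.Nat.Properties as ℕP
open import Algebra.Definitions using (Selective)
open import Algebra.Properties.CommutativeSemigroup ℕP.+-commutativeSemigroup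
  using () renaming (interchange to +-interchange)
open import Data.Bool using (true; false)
open import Data.Fin using (Fin; _≟_)
open import Data.Integer as ℤ using (+_; -[1+_])
import Data.Integer.Properties as ℤP
import Data.Integer.Solver as ℤSolver
open import Data.List as List using (List; []; _∷_; map; foldr; length; upTo; concatMap)
import Data.List.Properties as ListP
open import Data.List.Relation.Unary.All as All using (All; []; _∷_)
import Data.List.Relation.Unary.All.Properties as AllP
import Data.Nat.Solver as ℕSolver
open import Data.Nat.ListAction using (sum)
open import Data.Product using (_×_; _,_; proj₁; proj₂)
open import Data.Rational as ℚ using (mkℚ; _-_; ∣_∣)
import Data.Rational.Properties as ℚP
import Data.Rational.Solver as ℚSolver
import Data.Rational.Unnormalised as ℚᵘ
import Data.Rational.Unnormalised.Properties as ℚᵘP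
open import Data.Sum using (inj₁; inj₂)
open import Data.Vec as Vec using (Vec; []; _∷_; lookup)
import Data.Vec.Properties as VecP
import Data.Vec.Relation.Unary.All as VecAll
open import Function using (_∘_)
open import Relation.Binary.PropositionalEquality

p≤∣p∣ : ∀ p → p ℚ.≤ ∣ p ∣
p≤∣p∣ (mkℚ (+ _)    _ _) = ℚP.≤-refl
p≤∣p∣ p@(mkℚ -[1+ _ ] _ _) = ℚP.≤-trans (ℚ.*≤* ℤ.-≤+) (ℚP.0≤∣p∣ p)

∣r-p∣≤ε⇒∣r-q∣≤ε⇒p≤q+[ε+ε] : ∀ r {p q ε} → ∣ r - p ∣ ℚ.≤ ε → ∣ r - q ∣ ℚ.≤ ε →
                            p ℚ.≤ q ℚ.+ (ε ℚ.+ ε)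
∣r-p∣≤ε⇒∣r-q∣≤ε⇒p≤q+[ε+ε] r {p} {q} {ε} ∣r-p∣≤ε ∣r-q∣≤ε = begin
  p                                ≡⟨ rearrange r p q ⟩
  q ℚ.+ ((r - q) - (r - p))        ≤⟨ ℚP.+-monoʳ-≤ q (p≤∣p∣ _) ⟩
  q ℚ.+ ∣ (r - q) - (r - p) ∣      ≤⟨ ℚP.+-monoʳ-≤ q (ℚP.∣p-q∣≤∣p∣+∣q∣ (r - q) (r - p)) ⟩
  q ℚ.+ (∣ r - q ∣ ℚ.+ ∣ r - p ∣)  ≤⟨ ℚP.+-monoʳ-≤ q (ℚP.+-mono-≤ ∣r-q∣≤ε ∣r-p∣≤ε) ⟩
  q ℚ.+ (ε ℚ.+ ε)                  ∎
  where
  open ℚP.≤-Reasoning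
  open ℚSolver.+-*-Solver
  rearrange : ∀ r p q → p ≡ q ℚ.+ ((r - q) - (r - p))
  rearrange = solve 3 (λ r p q → p := q :+ ((r :- q) :- (r :- p))) refl

a≤ᵘb+n/3+n/3⇒3a≤3b+2n : ∀ a b n →
  ℚᵘ.mkℚᵘ (+ a) 0 ℚᵘ.≤ ℚᵘ.mkℚᵘ (+ b) 0 ℚᵘ.+ (ℚᵘ.mkℚᵘ (+ n) 2 ℚᵘ.+ ℚᵘ.mkℚᵘ (+ n) 2) →
  3 * a ≤ 3 * b + 2 * n
a≤ᵘb+n/3+n/3⇒3a≤3b+2n a b n (ℚᵘ.*≤* 9a≤9b+6n) =
  ℕP.*-cancelˡ-≤ 3 (subst₂ _≤_ (nine-times a) (nine-times-plus b n)
    (ℤP.drop‿+≤+ (subst₂ ℤ._≤_ (sym (ℤP.pos-* a 9)) cross-multiplied 9a≤9b+6n)))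
  where
  -- the shape in which ℚᵘ's _+_ and _≤_ leave the cross-multiplied right-hand side
  nine-times : ∀ a → a * 9 ≡ 3 * (3 * a)
  nine-times = solve 1 (λ a → a :* con 9 := con 3 :* (con 3 :* a)) refl
    where open ℕSolver.+-*-Solver
  nine-times-plus : ∀ b n → b * 9 + n * 6 ≡ 3 * (3 * b + 2 * n)
  nine-times-plus = solve 2 (λ b n → b :* con 9 :+ n :* con 6 := con 3 :* (con 3 :* b :+ con 2 :* n)) refl
    where open ℕSolver.+-*-Solver
  collect : ∀ b n → (b ℤ.* + 9 ℤ.+ (n ℤ.* + 3 ℤ.+ n ℤ.* + 3) ℤ.* + 1) ℤ.* + 1 ≡ b ℤ.* + 9 ℤ.+ n ℤ.* + 6
  collect = solve 2 (λ b n → (b :* con (+ 9) :+ (n :* con (+ 3) :+ n :* con (+ 3)) :* con (+ 1)) :* con (+ 1)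
                              := b :* con (+ 9) :+ n :* con (+ 6)) refl
    where open ℤSolver.+-*-Solver
  cross-multiplied : (+ b ℤ.* + 9 ℤ.+ (+ n ℤ.* + 3 ℤ.+ + n ℤ.* + 3) ℤ.* + 1) ℤ.* + 1
                   ≡ + (b * 9 + n * 6)
  cross-multiplied = begin
    (+ b ℤ.* + 9 ℤ.+ (+ n ℤ.* + 3 ℤ.+ + n ℤ.* + 3) ℤ.* + 1) ℤ.* + 1  ≡⟨ collect (+ b) (+ n) ⟩
    + b ℤ.* + 9 ℤ.+ + n ℤ.* + 6                                    ≡⟨ sym (cong₂ ℤ._+_ (ℤP.pos-* b 9) (ℤP.pos-* n 6)) ⟩
    + (b * 9) ℤ.+ + (n * 6)                                        ≡⟨ sym (ℤP.pos-+ (b * 9) (n * 6)) ⟩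
    + (b * 9 + n * 6)                                              ∎
    where open ≡-Reasoning

toℚᵘ-/ : ∀ i d → ℚ.toℚᵘ (i ℚ./ suc d) ℚᵘ.≃ ℚᵘ.mkℚᵘ i d
toℚᵘ-/ i d = ℚP.toℚᵘ-fromℚᵘ (ℚᵘ.mkℚᵘ i d)

a≤b+n/3+n/3⇒3a≤3b+2n : ∀ a b n →
  (+ a) ℚ./ 1 ℚ.≤ (+ b) ℚ./ 1 ℚ.+ ((+ n) ℚ./ 3 ℚ.+ (+ n) ℚ./ 3) → 3 * a ≤ 3 * b + 2 * n
a≤b+n/3+n/3⇒3a≤3b+2n a b n a≤b+n/3+n/3 = a≤ᵘb+n/3+n/3⇒3a≤3b+2n a b n
  (ℚᵘP.≤-respʳ-≃ rhs≃ (ℚᵘP.≤-respˡ-≃ (toℚᵘ-/ (+ a) 0) (ℚP.toℚᵘ-mono-≤ a≤b+n/3+n/3)))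
  where
  n/3+n/3≃ : ℚ.toℚᵘ ((+ n) ℚ./ 3 ℚ.+ (+ n) ℚ./ 3) ℚᵘ.≃ ℚᵘ.mkℚᵘ (+ n) 2 ℚᵘ.+ ℚᵘ.mkℚᵘ (+ n) 2
  n/3+n/3≃ = ℚᵘP.≃-trans (ℚP.toℚᵘ-homo-+ ((+ n) ℚ./ 3) _) (ℚᵘP.+-cong (toℚᵘ-/ (+ n) 2) (toℚᵘ-/ (+ n) 2))
  rhs≃ : ℚ.toℚᵘ ((+ b) ℚ./ 1 ℚ.+ ((+ n) ℚ./ 3 ℚ.+ (+ n) ℚ./ 3))
         ℚᵘ.≃ ℚᵘ.mkℚᵘ (+ b) 0 ℚᵘ.+ (ℚᵘ.mkℚᵘ (+ n) 2 ℚᵘ.+ ℚᵘ.mkℚᵘ (+ n) 2)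
  rhs≃ = ℚᵘP.≃-trans (ℚP.toℚᵘ-homo-+ ((+ b) ℚ./ 1) _) (ℚᵘP.+-cong (toℚᵘ-/ (+ b) 0) n/3+n/3≃)

module _ {a} {A : Set a} where

  foldr-preserves-sel : ∀ {f : A → A → A} → Selective _≡_ f →
                        (P : A → Set) {e : A} {xs : List A} → P e → All P xs → P (foldr f e xs)
  foldr-preserves-sel {f} f-sel P = ListP.foldr-preservesᵇ pres
    where
    pres : ∀ {x y} → P x → P y → P (f x y)
    pres {x} {y} px py with f-sel x y
    ... | inj₁ fxy≡x = subst P (sym fxy≡x) px
    ... | inj₂ fxy≡y = subst P (sym fxy≡y) py

  foldr-preserves-sel₂ : ∀ {f g : A → A → A} → Selective _≡_ f → Selective _≡_ g →
                         (R : A → A → Set) {e e′ : A} {xs : List A} →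
                         All (λ x → All (R x) (e′ ∷ xs)) (e ∷ xs) → R (foldr f e xs) (foldr g e′ xs)
  foldr-preserves-sel₂ {g = g} f-sel g-sel R {e′ = e′} {xs} (Re ∷ Rxs) =
    foldr-preserves-sel f-sel (λ x → R x (foldr g e′ xs)) (R-foldr Re) (All.map R-foldr Rxs)
    where
    R-foldr : ∀ {x} → All (R x) (e′ ∷ xs) → R x (foldr g e′ xs)
    R-foldr {x} (Rxe′ ∷ Rxxs) = foldr-preserves-sel g-sel (R x) Rxe′ Rxxs

c*sum≤length*B : ∀ {A : Set} c B (f : A → ℕ) → (∀ x → c * f x ≤ B) →
                 (xs : List A) → c * sum (map f xs) ≤ length xs * B
c*sum≤length*B c B f cf≤B []       = ℕP.≤-reflexive (ℕP.*-zeroʳ c)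
c*sum≤length*B c B f cf≤B (x ∷ xs) = begin
  c * (f x + sum (map f xs))    ≡⟨ ℕP.*-distribˡ-+ c (f x) _ ⟩
  c * f x + c * sum (map f xs)  ≤⟨ ℕP.+-mono-≤ (cf≤B x) (c*sum≤length*B c B f cf≤B xs) ⟩
  B + length xs * B             ∎
  where open ℕP.≤-Reasoning

c*sum≤c*sum+m*B : ∀ {A : Set} {m} c B (f g : A → ℕ) (zs : Vec A m) →
                  VecAll.All (λ z → c * f z ≤ c * g z + B) zs →
                  c * Vec.sum (Vec.map f zs) ≤ c * Vec.sum (Vec.map g zs) + m * B
c*sum≤c*sum+m*B c B f g []       VecAll.[]            = ℕP.m≤m+n (c * 0) 0
c*sum≤c*sum+m*B {m = suc m} c B f g (z ∷ zs) (cfz≤cgz+B VecAll.∷ pzs) = begin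
  c * (f z + F)                    ≡⟨ ℕP.*-distribˡ-+ c (f z) F ⟩
  c * f z + c * F                  ≤⟨ ℕP.+-mono-≤ cfz≤cgz+B (c*sum≤c*sum+m*B c B f g zs pzs) ⟩
  (c * g z + B) + (c * G + m * B)  ≡⟨ regroup (c * g z) (c * G) ⟩
  (c * g z + c * G) + (B + m * B)  ≡⟨ cong (_+ suc m * B) (ℕP.*-distribˡ-+ c (g z) G) ⟨
  c * (g z + G) + suc m * B        ∎
  where
  open ℕP.≤-Reasoning
  F G : ℕ
  F = Vec.sum (Vec.map f zs)
  G = Vec.sum (Vec.map g zs)
  regroup : ∀ x y → (x + B) + (y + m * B) ≡ (x + y) + (B + m * B)
  regroup x y = +-interchange x B y (m * B)

length-allVecs : ∀ {A : Set} m (xs : List A) → length (allVecs m xs) ≡ length xs ^ m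
length-allVecs zero    xs = refl
length-allVecs (suc m) xs = begin
  length (concatMap (λ x → map (x ∷_) (allVecs m xs)) xs)  ≡⟨ length-prepend-each xs ⟩
  length xs * length (allVecs m xs)                       ≡⟨ cong (length xs *_) (length-allVecs m xs) ⟩
  length xs * length xs ^ m                               ∎
  where
  open ≡-Reasoning
  length-prepend-each : ∀ ys → length (concatMap (λ y → map (y ∷_) (allVecs m xs)) ys)
                               ≡ length ys * length (allVecs m xs)
  length-prepend-each []       = refl
  length-prepend-each (y ∷ ys) = begin
    length (map (y ∷_) (allVecs m xs) List.++ concatMap _ ys)  ≡⟨ ListP.length-++ (map (y ∷_) (allVecs m xs)) ⟩
    length (map (y ∷_) (allVecs m xs)) + length (concatMap _ ys)
      ≡⟨ cong₂ _+_ (ListP.length-map (y ∷_) (allVecs m xs)) (length-prepend-each ys) ⟩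
    length (allVecs m xs) + length ys * length (allVecs m xs)  ∎

count≤n : ∀ {n k} (x : Input n k) (j : Fin k) → count x j ≤ n
count≤n []      j = z≤n
count≤n (a ∷ x) j with lookup a j
... | true  = s≤s (count≤n x j)
... | false = ℕP.m≤n⇒m≤1+n (count≤n x j)

module _ {n k : ℕ} (P : ROBP n k) (P-approx : ComputesApproxCount P) where
  open ROBP P

  final≡⇒3count≤3count+2n : ∀ {x x′} j → final x ≡ final x′ → 3 * count x j ≤ 3 * count x′ j + 2 * n
  final≡⇒3count≤3count+2n {x} {x′} j fx≡fx′ = a≤b+n/3+n/3⇒3a≤3b+2n (count x j) (count x′ j) n
    (∣r-p∣≤ε⇒∣r-q∣≤ε⇒p≤q+[ε+ε] (lookup (out (final x′)) j)
      (subst (λ w → ∣ lookup (out w) j - (+ count x j) ℚ./ 1 ∣ ℚ.≤ (+ n) ℚ./ 3) fx≡fx′ (P-approx x j))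
      (P-approx x′ j))

  3hi≤3lo+2n : ∀ v j → 3 * hi P v j ≤ 3 * lo P v j + 2 * n
  3hi≤3lo+2n v j = foldr-preserves-sel₂ ℕP.⊔-sel ℕP.⊓-sel R
    (All.universal (λ _ → z≤n) _ ∷ AllP.map⁺ (All.map row reaches))
    where
    R : ℕ → ℕ → Set
    R a b = 3 * a ≤ 3 * b + 2 * n
    reaches : All (λ x → final x ≡ v) (reaching P v)
    reaches = AllP.all-filter (λ x → final x ≟ v) (allInputs n k)
    row : ∀ {x} → final x ≡ v → All (R (count x j)) (n ∷ map (λ x′ → count x′ j) (reaching P v))
    row {x} fx≡v = ℕP.≤-trans (ℕP.*-monoʳ-≤ 3 (count≤n x j)) (ℕP.m≤m+n (3 * n) (2 * n))
                 ∷ AllP.map⁺ (All.map (λ fx′≡v → final≡⇒3count≤3count+2n j (trans fx≡v (sym fx′≡v))) reaches)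

  3[sumHi∸sum]≤k*2n : ∀ {y v} → InR P y v → 3 * (sumHi P v ∸ Vec.sum y) ≤ k * (2 * n)
  3[sumHi∸sum]≤k*2n {y} {v} y∈Rv = begin
    3 * (sumHi P v ∸ Vec.sum y)    ≡⟨ ℕP.*-distribˡ-∸ 3 (sumHi P v) (Vec.sum y) ⟩
    3 * sumHi P v ∸ 3 * Vec.sum y  ≤⟨ ℕP.m≤n+o⇒m∸n≤o (3 * sumHi P v) (3 * Vec.sum y) 3Σhi≤3Σy+k*2n ⟩
    k * (2 * n)                    ∎
    where
    open ℕP.≤-Reasoning
    zs : Vec (Fin k × ℕ) k
    zs = Vec.zip (Vec.allFin k) y
    Σhi : Vec.sum (Vec.map (hi P v ∘ proj₁) zs) ≡ sumHi P v
    Σhi = cong Vec.sum (trans (VecP.map-∘ (hi P v) proj₁ zs)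
                              (cong (Vec.map (hi P v)) (VecP.map-proj₁-zip (Vec.allFin k) y)))
    Σy : Vec.sum (Vec.map proj₂ zs) ≡ Vec.sum y
    Σy = cong Vec.sum (VecP.map-proj₂-zip (Vec.allFin k) y)
    3Σhi≤3Σy+k*2n : 3 * sumHi P v ≤ 3 * Vec.sum y + k * (2 * n)
    3Σhi≤3Σy+k*2n = subst₂ (λ s t → 3 * s ≤ 3 * t + k * (2 * n)) Σhi Σy
      (c*sum≤c*sum+m*B 3 (2 * n) (hi P v ∘ proj₁) proj₂ zs (VecAll.map
        (λ { {j , yj} (lo≤yj , _) → ℕP.≤-trans (3hi≤3lo+2n v j) (ℕP.+-monoˡ-≤ (2 * n) (ℕP.*-monoʳ-≤ 3 lo≤yj)) })
        y∈Rv))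

  3φ≤k*2n : ∀ y → 3 * φ P y ≤ k * (2 * n)
  3φ≤k*2n y = foldr-preserves-sel ℕP.⊔-sel (λ m → 3 * m ≤ k * (2 * n)) z≤n
    (AllP.map⁺ (All.map 3[sumHi∸sum]≤k*2n (AllP.all-filter (inR? P y) (List.allFin (width n)))))

lemma5p6 : ∀ (n k : ℕ) → 1 ≤ k → 1 ≤ n → (P : ROBP n k) →
    ROBP.AllReachable P → ComputesApproxCount P →
    3 * Φ P ≤ (suc (n / 10)) ^ k * (2 * k * n)
lemma5p6 n k _ _ P _ P-approx = begin
  3 * Φ P                          ≤⟨ c*sum≤length*B 3 (k * (2 * n)) (φ P) (3φ≤k*2n P P-approx) (grid P) ⟩
  length (grid P) * (k * (2 * n))  ≡⟨ cong₂ _*_ length-grid k*[2*n]≡2*k*n ⟩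
  suc (n / 10) ^ k * (2 * k * n)   ∎
  where
  open ℕP.≤-Reasoning
  length-grid : length (grid P) ≡ suc (n / 10) ^ k
  length-grid = trans (length-allVecs k (upTo (suc (n / 10)))) (cong (_^ k) (ListP.length-upTo (suc (n / 10))))
  k*[2*n]≡2*k*n : k * (2 * n) ≡ 2 * k * n
  k*[2*n]≡2*k*n = trans (sym (ℕP.*-assoc k 2 n)) (cong (_* n) (ℕP.*-comm k 2))
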